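{- On a directed circulant graph with $n$ vertices and no loops, there is no nonprimitive circuit, and hence no nonprimitive periodic orbit, with walk sum $n$.
   Context: A directed circulant graph with arc set $\mathscr{A}\subset\{1,\dots,n-1\}$ has vertex set $\{0,\dots,n-1\}$ (identified with $\mathbb{Z}/n\mathbb{Z}$) and bonds $(v,v+a\bmod n)$ for all vertices $v$ and $a\in\mathscr{A}$ (no loops means $0\notin\mathscr{A}$). The arc of a bond $(v_0,v_1)$ is $(v_1-v_0)\bmod n$. A circuit is a sequence $v_0,\dots,v_l=v_0$ ($l\ge1$) with each $(v_i,v_{i+1})$ a bond; its walk sum is the sum of the arcs of its bonds counted with repetition. A periodic orbit is an equivalence class of circuits under cyclic rotation, with walk sum that of any of its circuits. A circuit (periodic orbit) is nonprimitive if it consists of a shorter circuit (periodic orbit) repeated at least twice. -}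

module Defs where

open import Data.Nat using (ℕ; zero; suc; _+_; _*_; _∸_; _%_; _≤_; _<_; NonZero)
open import Data.Fin using (Fin; toℕ)
open import Data.Product using (Σ; _×_; ∃)
open import Relation.Binary.PropositionalEquality using (_≡_)

-- Directed circulant graph on vertex set Fin n (= ℤ/nℤ), arc set given as a
-- predicate on ℕ.  "No loops" and "A ⊆ {1,…,n-1}" is the hypothesis below.
ArcSet : Set₁
ArcSet = ℕ → Set

ValidArcSet : ℕ → ArcSet → Set
ValidArcSet n A = ∀ a → A a → 1 ≤ a × a < n

arc : (n : ℕ) .{{_ : NonZero n}} → Fin n → Fin n → ℕ
arc n v w = (n + toℕ w ∸ toℕ v) % n

-- (v , w) is a bond: w = v + a mod n for some a ∈ A, i.e. its arc lies in A
IsBond : (n : ℕ) .{{_ : NonZero n}} → ArcSet → Fin n → Fin n → Set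
IsBond n A v w = A (arc n v w)

-- A circuit v₀,…,v_l = v₀ with l ≥ 1.  The vertex sequence is stored as a
-- function ℕ → Fin n; only the values at indices 0,…,l are meaningful.
record Circuit (n : ℕ) .{{_ : NonZero n}} (A : ArcSet) : Set where
  field
    len    : ℕ
    len≥1  : 1 ≤ len
    vert   : ℕ → Fin n
    closed : vert len ≡ vert 0
    bonds  : ∀ i → i < len → IsBond n A (vert i) (vert (suc i))
open Circuit public

sumBelow : ℕ → (ℕ → ℕ) → ℕ
sumBelow zero    f = 0
sumBelow (suc l) f = sumBelow l f + f l

walkSum : {n : ℕ} .{{_ : NonZero n}} {A : ArcSet} → Circuit n A → ℕ
walkSum {n} C = sumBelow (len C) (λ i → arc n (vert C i) (vert C (suc i)))

Nonprimitive : {n : ℕ} .{{_ : NonZero n}} {A : ArcSet} → Circuit n A → Set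
Nonprimitive {n} {A} C =
  Σ (Circuit n A) λ C' → Σ ℕ λ k →
    (2 ≤ k) × (len C ≡ k * len C') ×
    (∀ j i → j < k → i ≤ len C' → vert C (j * len C' + i) ≡ vert C' i)

{-# OPTIONS --safe #-}
module Submission where

-- The arc of a bond (v , w) is w − v modulo n, so the arcs along a circuit telescope:
-- every walk sum is a multiple of n, and it is positive because every arc is at least 1.
-- Hence every circuit has walk sum at least n, while a circuit repeating a shorter one
-- k ≥ 2 times has k times its walk sum, which is at least 2n > n.

open import Defs
open import Data.Nat using (ℕ; NonZero; >-nonZero; >-nonZero⁻¹; zero; suc; _+_; _*_; _∸_; _%_; _≤_; _<_; _>_; _≤?_; z<s; s<s)
open import Data.Nat.Properties
open import Data.Nat.DivMod using ([m+n]%n≡m%n; m<n⇒m%n≡m)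
open import Data.Nat.Divisibility using (_∣_; divides; ∣⇒≤)
open import Data.Nat.Tactic.RingSolver using (solve)
open import Data.Fin using (Fin; toℕ)
open import Data.Fin.Properties using (toℕ<n)
open import Data.List using (_∷_; [])
open import Data.Product using (∃; _,_; proj₁)
open import Relation.Binary.PropositionalEquality
open import Relation.Nullary using (¬_; yes; no)

+-telescope-step : ∀ s a u v w d D n → s + u ≡ v + D * n → a + v ≡ w + d * n →
              s + a + u ≡ w + (d + D) * n
+-telescope-step s a u v w d D n sum≡ arc≡ = begin
  s + a + u         ≡⟨ solve (s ∷ a ∷ u ∷ []) ⟩
  (s + u) + a       ≡⟨ cong (_+ a) sum≡ ⟩
  v + D * n + a     ≡⟨ solve (v ∷ a ∷ D ∷ n ∷ []) ⟩
  (a + v) + D * n   ≡⟨ cong (_+ D * n) arc≡ ⟩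
  w + d * n + D * n ≡⟨ solve (w ∷ d ∷ D ∷ n ∷ []) ⟩
  w + (d + D) * n   ∎
  where open ≡-Reasoning

sumBelow-+ : ∀ a b f → sumBelow (a + b) f ≡ sumBelow a f + sumBelow b (λ i → f (a + i))
sumBelow-+ a zero f rewrite +-identityʳ a = sym (+-identityʳ _)
sumBelow-+ a (suc b) f rewrite +-suc a b | sumBelow-+ a b f = +-assoc (sumBelow a f) _ _

sumBelow-cong : ∀ m {f g} → (∀ i → i < m → f i ≡ g i) → sumBelow m f ≡ sumBelow m g
sumBelow-cong zero    f≡g = refl
sumBelow-cong (suc m) f≡g =
  cong₂ _+_ (sumBelow-cong m (λ i i<m → f≡g i (m<n⇒m<1+n i<m))) (f≡g m ≤-refl)

sumBelow-periodic : ∀ k m f g → (∀ j i → j < k → i < m → f (j * m + i) ≡ g i) →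
                    sumBelow (k * m) f ≡ k * sumBelow m g
sumBelow-periodic zero    m f g periodic = refl
sumBelow-periodic (suc k) m f g periodic = begin
  sumBelow (m + k * m) f
    ≡⟨ sumBelow-+ m (k * m) f ⟩
  sumBelow m f + sumBelow (k * m) (λ i → f (m + i))
    ≡⟨ cong₂ _+_ (sumBelow-cong m (λ i → periodic 0 i z<s))
                 (sumBelow-periodic k m (λ i → f (m + i)) g shifted) ⟩
  sumBelow m g + k * sumBelow m g ∎
  where
  open ≡-Reasoning
  shifted : ∀ j i → j < k → i < m → f (m + (j * m + i)) ≡ g i
  shifted j i j<k i<m = trans (cong f (sym (+-assoc m (j * m) i))) (periodic (suc j) i (s<s j<k) i<m)

sumBelow-positive : ∀ {l f} → l > 0 → (∀ i → i < l → f i > 0) → sumBelow l f > 0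
sumBelow-positive {suc l} {f} _ f>0 = ≤-trans (f>0 l ≤-refl) (m≤n+m (f l) (sumBelow l f))

module _ (n : ℕ) .{{_ : NonZero n}} where

  arc+v≡w+d*n : ∀ v w → ∃ λ d → arc n v w + toℕ v ≡ toℕ w + d * n
  arc+v≡w+d*n v w with toℕ v ≤? toℕ w
  ... | yes v≤w = 0 , (begin
    (n + toℕ w ∸ toℕ v) % n + toℕ v   ≡⟨ cong (λ x → x % n + toℕ v) (+-∸-assoc n v≤w) ⟩
    (n + (toℕ w ∸ toℕ v)) % n + toℕ v ≡⟨ cong (λ x → x % n + toℕ v) (+-comm n (toℕ w ∸ toℕ v)) ⟩
    ((toℕ w ∸ toℕ v) + n) % n + toℕ v ≡⟨ cong (_+ toℕ v) ([m+n]%n≡m%n (toℕ w ∸ toℕ v) n) ⟩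
    (toℕ w ∸ toℕ v) % n + toℕ v       ≡⟨ cong (_+ toℕ v) (m<n⇒m%n≡m w∸v<n) ⟩
    (toℕ w ∸ toℕ v) + toℕ v           ≡⟨ m∸n+n≡m v≤w ⟩
    toℕ w                             ≡⟨ +-identityʳ (toℕ w) ⟨
    toℕ w + 0 * n                     ∎)
    where
    open ≡-Reasoning
    w∸v<n : toℕ w ∸ toℕ v < n
    w∸v<n = ≤-<-trans (m∸n≤m (toℕ w) (toℕ v)) (toℕ<n w)
  ... | no v≰w = 1 , (begin
    (n + toℕ w ∸ toℕ v) % n + toℕ v ≡⟨ cong (_+ toℕ v) (m<n⇒m%n≡m n+w∸v<n) ⟩
    n + toℕ w ∸ toℕ v + toℕ v       ≡⟨ ∸-+-cancel ⟩
    n + toℕ w                       ≡⟨ +-comm n (toℕ w) ⟩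
    toℕ w + n                       ≡⟨ cong (toℕ w +_) (*-identityˡ n) ⟨
    toℕ w + 1 * n                   ∎)
    where
    open ≡-Reasoning
    ∸-+-cancel : n + toℕ w ∸ toℕ v + toℕ v ≡ n + toℕ w
    ∸-+-cancel = m∸n+n≡m (≤-trans (<⇒≤ (toℕ<n v)) (m≤m+n n (toℕ w)))
    n+w∸v<n : n + toℕ w ∸ toℕ v < n
    n+w∸v<n = +-cancelʳ-< (toℕ v) (n + toℕ w ∸ toℕ v) n
      (subst (_< n + toℕ v) (sym ∸-+-cancel) (+-monoʳ-< n (≰⇒> v≰w)))

  arcsAlong : (ℕ → Fin n) → ℕ → ℕ
  arcsAlong vt i = arc n (vt i) (vt (suc i))

  arcSum-telescopes : ∀ (vt : ℕ → Fin n) l →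
    ∃ λ D → sumBelow l (arcsAlong vt) + toℕ (vt 0) ≡ toℕ (vt l) + D * n
  arcSum-telescopes vt zero = 0 , sym (+-identityʳ _)
  arcSum-telescopes vt (suc l) with arcSum-telescopes vt l | arc+v≡w+d*n (vt l) (vt (suc l))
  ... | D , sum≡ | d , arc≡ = d + D ,
    +-telescope-step (sumBelow l (arcsAlong vt)) (arcsAlong vt l) (toℕ (vt 0)) (toℕ (vt l)) (toℕ (vt (suc l)))
                     d D n sum≡ arc≡

  walkSum-divisible : ∀ {A} (C : Circuit n A) → n ∣ walkSum C
  walkSum-divisible C with arcSum-telescopes (vert C) (len C)
  ... | D , sum≡ = divides D (+-cancelʳ-≡ (toℕ (vert C 0)) (walkSum C) (D * n) (begin
    walkSum C + toℕ (vert C 0)   ≡⟨ sum≡ ⟩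
    toℕ (vert C (len C)) + D * n ≡⟨ cong (λ v → toℕ v + D * n) (closed C) ⟩
    toℕ (vert C 0) + D * n       ≡⟨ +-comm (toℕ (vert C 0)) (D * n) ⟩
    D * n + toℕ (vert C 0)       ∎))
    where open ≡-Reasoning

  walkSum-positive : ∀ {A} → ValidArcSet n A → (C : Circuit n A) → walkSum C > 0
  walkSum-positive valid C =
    sumBelow-positive (len≥1 C) (λ i i<len → proj₁ (valid (arcsAlong (vert C) i) (bonds C i i<len)))

  n≤walkSum : ∀ {A} → ValidArcSet n A → (C : Circuit n A) → n ≤ walkSum C
  n≤walkSum valid C = ∣⇒≤ {{>-nonZero (walkSum-positive valid C)}} (walkSum-divisible C)

  walkSum-repeat : ∀ {A} (C C' : Circuit n A) k → len C ≡ k * len C' →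
    (∀ j i → j < k → i ≤ len C' → vert C (j * len C' + i) ≡ vert C' i) →
    walkSum C ≡ k * walkSum C'
  walkSum-repeat C C' k len≡ repeats = begin
    walkSum C                                   ≡⟨ cong (λ l → sumBelow l (arcsAlong (vert C))) len≡ ⟩
    sumBelow (k * len C') (arcsAlong (vert C))  ≡⟨ sumBelow-periodic k (len C') _ _ arcs-repeat ⟩
    k * walkSum C'                              ∎
    where
    open ≡-Reasoning
    arcs-repeat : ∀ j i → j < k → i < len C' →
                  arcsAlong (vert C) (j * len C' + i) ≡ arcsAlong (vert C') i
    arcs-repeat j i j<k i<len = cong₂ (arc n) (repeats j i j<k (<⇒≤ i<len))
      (trans (cong (vert C) (sym (+-suc (j * len C') i))) (repeats j (suc i) j<k i<len))

lemma4 : (n : ℕ) .{{_ : NonZero n}} (A : ArcSet) → ValidArcSet n A →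
    (C : Circuit n A) → walkSum C ≡ n → ¬ Nonprimitive C
lemma4 n A valid C walkSum≡n (C' , k , 2≤k , len≡ , repeats) = <-irrefl (sym walkSum≡n) (begin-strict
  n              <⟨ m<m+n n (>-nonZero⁻¹ n) ⟩
  n + n          ≡⟨ cong (n +_) (+-identityʳ n) ⟨
  2 * n          ≤⟨ *-mono-≤ 2≤k (n≤walkSum n valid C') ⟩
  k * walkSum C' ≡⟨ walkSum-repeat n C C' k len≡ repeats ⟨
  walkSum C      ∎)
  where open ≤-Reasoning
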